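{- Let $n>1$ and $m$ be integers with $0<m<n$, let $\mathcal{F}(n,m)=(\tfrac{h}{k}\in\mathcal{F}_n:\ h\le m,\ k-h\le n-m)$, $\mathcal{F}^{\le 1/2}(n,m)=(\tfrac{h}{k}\in\mathcal{F}(n,m):\ \tfrac{h}{k}\le\tfrac12)$ and $\mathcal{F}^{\ge 1/2}(n,m)=(\tfrac{h}{k}\in\mathcal{F}(n,m):\ \tfrac{h}{k}\ge\tfrac12)$. (i) Suppose $m\ge\tfrac n2$. Then the map $\mathcal{F}^{\le1/2}(n,m)\to\mathcal{F}^{\le1/2}(n,m)$, $\tfrac hk\mapsto\tfrac{k-2h}{2k-3h}$, is well defined, order-reversing and bijective; the map $\mathcal{F}^{\le1/2}(n,m)\to\mathcal{F}^{\ge1/2}(n,m)$, $\tfrac hk\mapsto\tfrac{k-h}{2k-3h}$, is well defined, order-preserving and injective; and the map $\mathcal{F}^{\le1/2}(n,m)\to\mathcal{F}^{\ge1/2}(n,m)$, $\tfrac hk\mapsto\tfrac{k-h}{k}$, is well defined, order-reversing and injective. (ii) Suppose $m\le\tfrac n2$. Then the map $\mathcal{F}^{\ge1/2}(n,m)\to\mathcal{F}^{\ge1/2}(n,m)$, $\tfrac hk\mapsto\tfrac{h}{3h-k}$, is well defined, order-reversing and bijective; the map $\mathcal{F}^{\ge1/2}(n,m)\to\mathcal{F}^{\le1/2}(n,m)$, $\tfrac hk\mapsto\tfrac{2h-k}{3h-k}$, is well defined, order-preserving and injective; and the map $\mathcal{F}^{\ge1/2}(n,m)\to\mathcal{F}^{\le1/2}(n,m)$,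 $\tfrac hk\mapsto\tfrac{k-h}{k}$, is well defined, order-reversing and injective.
   Context: For an integer $q\ge1$, the Farey sequence $\mathcal{F}_q$ is the ascending sequence of all irreducible fractions $\tfrac hk$ (with $h\ge0$, $k\ge1$, $\gcd(h,k)=1$) such that $\tfrac01\le\tfrac hk\le\tfrac11$ and $1\le k\le q$. All sequences are ordered by the usual order of rationals; the formulas in the maps are applied to fractions written in lowest terms. -}

module Defs where

open import Data.Nat using (ℕ; _+_; _*_; _∸_; _≤_; _<_)
open import Data.Nat.Coprimality using (Coprime)
open import Data.Product using (_×_; _,_; Σ; ∃)
open import Relation.Binary.PropositionalEquality using (_≡_)

-- A fraction h/k is represented by the pair (h , k) of naturals; membership
-- predicates below require lowest terms (Coprime h k) and k ≥ 1, so each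
-- rational is represented by exactly one pair.
Frac : Set
Frac = ℕ × ℕ

InF : ℕ → ℕ → Frac → Set
InF n m (h , k) =
  Coprime h k × 1 ≤ k × k ≤ n × h ≤ k × h ≤ m × k ∸ h ≤ n ∸ m

InLo : ℕ → ℕ → Frac → Set
InLo n m (h , k) = InF n m (h , k) × 2 * h ≤ k

InHi : ℕ → ℕ → Frac → Set
InHi n m (h , k) = InF n m (h , k) × k ≤ 2 * h

_<F_ : Frac → Frac → Set
(h , k) <F (h' , k') = h * k' < h' * k

WellDefined : (Frac → Set) → (Frac → Set) → (Frac → Frac) → Set
WellDefined A B f = ∀ x → A x → B (f x)

OrderPreserving : (Frac → Set) → (Frac → Frac) → Set
OrderPreserving A f = ∀ x y → A x → A y → x <F y → f x <F f y

OrderReversing : (Frac → Set) → (Frac → Frac) → Set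
OrderReversing A f = ∀ x y → A x → A y → x <F y → f y <F f x

InjectiveOn : (Frac → Set) → (Frac → Frac) → Set
InjectiveOn A f = ∀ x y → A x → A y → f x ≡ f y → x ≡ y

SurjectiveOnto : (Frac → Set) → (Frac → Set) → (Frac → Frac) → Set
SurjectiveOnto A B f = ∀ y → B y → Σ Frac (λ x → A x × f x ≡ y)

BijectiveOnto : (Frac → Set) → (Frac → Set) → (Frac → Frac) → Set
BijectiveOnto A B f = InjectiveOn A f × SurjectiveOnto A B f

-- The maps (truncated subtraction is exact on the relevant domains).
-- (i): h/k ↦ (k-2h)/(2k-3h),  h/k ↦ (k-h)/(2k-3h)
φ₁ φ₂ : Frac → Frac
φ₁ (h , k) = (k ∸ 2 * h , 2 * k ∸ 3 * h)
φ₂ (h , k) = (k ∸ h , 2 * k ∸ 3 * h)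

ψ₁ ψ₂ : Frac → Frac
ψ₁ (h , k) = (h , 3 * h ∸ k)
ψ₂ (h , k) = (2 * h ∸ k , 3 * h ∸ k)

σ : Frac → Frac
σ (h , k) = (k ∸ h , k)

{-# OPTIONS --safe #-}
module Submission where

-- Parametrise 𝓕^{≤1/2}(n,m) by coprime pairs (a , d) via a/(2a+d), and 𝓕^{≥1/2}(n,m)
-- via (a+d)/(2a+d); the constraints h ≤ m, k − h ≤ n − m become a ≤ m, a + d ≤ n − m,
-- respectively a ≤ n − m, a + d ≤ m.  The first parametrisation preserves and the second
-- reverses the order a/d < b/e of the parameters.  In these coordinates each of the six
-- maps is (a , d) ↦ (d , a) or the identity, followed by a change of parametrisation, and
-- (a , d) ↦ (d , a) reverses a/d; so the order statements and injectivity are immediate.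
-- Well-definedness reduces to the constraints being symmetric in a and d, which holds
-- because the hypothesis on m makes the bound on a + d the smaller of m and n − m.

open import Defs
open import Data.Nat using (ℕ; _*_; _≤_; _<_)
open import Data.Product using (_×_)

open import Data.Nat using (zero; suc; _+_; _∸_; s≤s; z≤n)
open import Data.Nat.Properties
open import Data.Nat.Coprimality using (Coprime; coprime-+; 0-coprimeTo-m⇒m≡1)
import Data.Nat.Coprimality as Coprime
open import Data.Nat.Divisibility using (∣m∣n⇒∣m+n)
open import Data.Nat.Tactic.RingSolver using (solve)
open import Data.List using (_∷_; [])
open import Data.Product using (_,_; swap)
open import Data.Product.Properties using (,-injectiveˡ; ,-injectiveʳ)
open import Function using (_∘_; id)
open import Relation.Binary.PropositionalEquality

m≡n+o⇒m∸n≡o : ∀ {m} n {o} → m ≡ n + o → m ∸ n ≡ o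
m≡n+o⇒m∸n≡o n {o} refl = m+n∸m≡n n o

2*m≡m+m : ∀ m → 2 * m ≡ m + m
2*m≡m+m m = cong (m +_) (+-identityʳ m)

2*m≤m+n⇒m≤n : ∀ {m n} → 2 * m ≤ m + n → m ≤ n
2*m≤m+n⇒m≤n {m} le = +-cancelˡ-≤ m _ _ (≤-trans (≤-reflexive (sym (2*m≡m+m m))) le)

m≤n⇒2*m≤m+n : ∀ {m n} → m ≤ n → 2 * m ≤ m + n
m≤n⇒2*m≤m+n {m} le = ≤-trans (≤-reflexive (2*m≡m+m m)) (+-monoʳ-≤ m le)

m+n≤2*m⇒n≤m : ∀ {m n} → m + n ≤ 2 * m → n ≤ m
m+n≤2*m⇒n≤m {m} le = +-cancelˡ-≤ m _ _ (≤-trans le (≤-reflexive (2*m≡m+m m)))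

n≤m⇒m+n≤2*m : ∀ {m n} → n ≤ m → m + n ≤ 2 * m
n≤m⇒m+n≤2*m {m} le = ≤-trans (+-monoʳ-≤ m le) (≤-reflexive (sym (2*m≡m+m m)))

2*m∸m≡m : ∀ m → 2 * m ∸ m ≡ m
2*m∸m≡m m = trans (cong (_∸ m) (2*m≡m+m m)) (m+n∸m≡n m m)

n≤2*m⇒n∸m≤m : ∀ {m n} → n ≤ 2 * m → n ∸ m ≤ m
n≤2*m⇒n∸m≤m {m} le = ≤-trans (∸-monoˡ-≤ m le) (≤-reflexive (2*m∸m≡m m))

2*m≤n⇒m≤n∸m : ∀ {m n} → 2 * m ≤ n → m ≤ n ∸ m
2*m≤n⇒m≤n∸m {m} le = ≤-trans (≤-reflexive (sym (2*m∸m≡m m))) (∸-monoˡ-≤ m le)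

coprime-+ʳ : ∀ {x y} → Coprime x y → Coprime x (x + y)
coprime-+ʳ c = Coprime.sym (coprime-+ (Coprime.sym c))

coprime-+ʳ⁻¹ : ∀ {x y} → Coprime x (x + y) → Coprime x y
coprime-+ʳ⁻¹ c (d∣x , d∣y) = c (d∣x , ∣m∣n⇒∣m+n d∣x d∣y)

coprime⇒1≤+ : ∀ {x y} → Coprime x y → 1 ≤ x + y
coprime⇒1≤+ {suc x} {y} c = s≤s z≤n
coprime⇒1≤+ {zero} {suc y} c = s≤s z≤n
coprime⇒1≤+ {zero} {zero} c with () ← 0-coprimeTo-m⇒m≡1 c

shear : Frac → Frac
shear (x , y) = (x , x + y)

-- lo (a , d) = a/(2a+d) and hi (a , d) = (a+d)/(2a+d).
lo hi : Frac → Frac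
lo = shear ∘ shear
hi = shear ∘ swap ∘ shear

data Image (g : Frac → Frac) (P : Frac → Set) : Frac → Set where
  image : ∀ {p} → P p → Image g P (g p)

-- h/k ∈ 𝓕(n,m) in the coordinates (h , k − h) is Bounded m (n − m).
Bounded : ℕ → ℕ → Frac → Set
Bounded s t (x , y) = Coprime x y × x ≤ s × y ≤ t

Admissible : ℕ → ℕ → Frac → Set
Admissible s t (a , d) = Coprime a d × a ≤ s × a + d ≤ t

m*[n+o]≡n*m+m*o : ∀ m n o → m * (n + o) ≡ n * m + m * o
m*[n+o]≡n*m+m*o m n o = trans (*-distribˡ-+ m n o) (cong (_+ m * o) (*-comm m n))

-- Cross-multiplying x/(x+y) < x′/(x′+y′) adds x x′ to both sides of x y′ < x′ y.
shear-<F : ∀ {p q} → p <F q → shear p <F shear q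
shear-<F {x , y} {x′ , y′} lt =
  subst₂ _<_ (sym (*-distribˡ-+ x x′ y′)) (sym (m*[n+o]≡n*m+m*o x′ x y))
    (+-monoʳ-< (x * x′) lt)

shear-<F⁻¹ : ∀ {p q} → shear p <F shear q → p <F q
shear-<F⁻¹ {x , y} {x′ , y′} lt =
  +-cancelˡ-< (x * x′) _ _
    (subst₂ _<_ (*-distribˡ-+ x x′ y′) (m*[n+o]≡n*m+m*o x′ x y) lt)

swap-<F : ∀ p q → p <F q → swap q <F swap p
swap-<F (a , d) (b , e) = subst₂ _<_ (*-comm a e) (*-comm b d)

lo-<F : ∀ p q → p <F q → lo p <F lo q
lo-<F p q = shear-<F {shear p} {shear q} ∘ shear-<F {p} {q}

lo-<F⁻¹ : ∀ p q → lo p <F lo q → p <F q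
lo-<F⁻¹ p q = shear-<F⁻¹ {p} {q} ∘ shear-<F⁻¹ {shear p} {shear q}

hi-<F : ∀ p q → p <F q → hi q <F hi p
hi-<F p q =
  shear-<F {swap (shear q)} {swap (shear p)} ∘ swap-<F (shear p) (shear q) ∘ shear-<F {p} {q}

hi-<F⁻¹ : ∀ p q → hi p <F hi q → q <F p
hi-<F⁻¹ p q =
  shear-<F⁻¹ {q} {p} ∘ swap-<F (swap (shear p)) (swap (shear q))
    ∘ shear-<F⁻¹ {swap (shear p)} {swap (shear q)}

shear-injective : ∀ {p q} → shear p ≡ shear q → p ≡ q
shear-injective {x , y} {x′ , y′} eq with refl ← ,-injectiveˡ eq =
  cong (x ,_) (+-cancelˡ-≡ x y y′ (,-injectiveʳ eq))

lo-injective : ∀ {p q} → lo p ≡ lo q → p ≡ q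
lo-injective {p} {q} = shear-injective {p} {q} ∘ shear-injective {shear p} {shear q}

hi-injective : ∀ {p q} → hi p ≡ hi q → p ≡ q
hi-injective {p} {q} =
  shear-injective {p} {q} ∘ cong swap ∘ shear-injective {swap (shear p)} {swap (shear q)}

module _ {n m : ℕ} (m≤n : m ≤ n) where

  shear-InF : ∀ {p} → Bounded m (n ∸ m) p → InF n m (shear p)
  shear-InF {x , y} (c , x≤m , y≤n∸m) =
    coprime-+ʳ c , coprime⇒1≤+ c ,
    ≤-trans (+-mono-≤ x≤m y≤n∸m) (≤-reflexive (m+[n∸m]≡n m≤n)) ,
    m≤m+n x y , x≤m , ≤-trans (≤-reflexive (m+n∸m≡n x y)) y≤n∸m

  shear-view : ∀ {x} → InF n m x → Image shear (Bounded m (n ∸ m)) x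
  shear-view {h , k} (c , _ , _ , h≤k , h≤m , k∸h≤n∸m)
    with d , refl ← m≤n⇒∃[o]m+o≡n h≤k =
    image (coprime-+ʳ⁻¹ c , h≤m , ≤-trans (≤-reflexive (sym (m+n∸m≡n h d))) k∸h≤n∸m)

  lo-InLo : ∀ {p} → Admissible m (n ∸ m) p → InLo n m (lo p)
  lo-InLo {a , d} (c , a≤m , a+d≤n∸m) =
    shear-InF (coprime-+ʳ c , a≤m , a+d≤n∸m) , m≤n⇒2*m≤m+n (m≤m+n a d)

  hi-InHi : ∀ {p} → Admissible (n ∸ m) m p → InHi n m (hi p)
  hi-InHi {a , d} (c , a≤n∸m , a+d≤m) =
    shear-InF (Coprime.sym (coprime-+ʳ c) , a+d≤m , a≤n∸m) , n≤m⇒m+n≤2*m (m≤m+n a d)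

  lo-view : ∀ {x} → InLo n m x → Image lo (Admissible m (n ∸ m)) x
  lo-view (Fx , 2h≤k) with shear-view Fx
  ... | image {h , y} (c , h≤m , y≤n∸m)
    with d , refl ← m≤n⇒∃[o]m+o≡n (2*m≤m+n⇒m≤n {h} 2h≤k) =
    image (coprime-+ʳ⁻¹ c , h≤m , y≤n∸m)

  hi-view : ∀ {x} → InHi n m x → Image hi (Admissible (n ∸ m) m) x
  hi-view (Fx , k≤2h) with shear-view Fx
  ... | image {h , y} (c , h≤m , y≤n∸m)
    with d , refl ← m≤n⇒∃[o]m+o≡n (m+n≤2*m⇒n≤m {h} k≤2h) =
    image (coprime-+ʳ⁻¹ (Coprime.sym c) , y≤n∸m , h≤m)

φ₁-lo : ∀ p → φ₁ (lo p) ≡ lo (swap p)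
φ₁-lo (a , d) = cong₂ _,_
  (m≡n+o⇒m∸n≡o (2 * a) {d} (solve (a ∷ d ∷ [])))
  (m≡n+o⇒m∸n≡o (3 * a) {d + (d + a)} (solve (a ∷ d ∷ [])))

φ₂-lo : ∀ p → φ₂ (lo p) ≡ hi (swap p)
φ₂-lo (a , d) = cong₂ _,_
  (m≡n+o⇒m∸n≡o a {d + a} (solve (a ∷ d ∷ [])))
  (m≡n+o⇒m∸n≡o (3 * a) {d + a + d} (solve (a ∷ d ∷ [])))

σ-lo : ∀ p → σ (lo p) ≡ hi p
σ-lo (a , d) = cong₂ _,_ (m+n∸m≡n a (a + d)) (+-comm a (a + d))

ψ₁-hi : ∀ p → ψ₁ (hi p) ≡ hi (swap p)
ψ₁-hi (a , d) = cong₂ _,_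
  (+-comm a d)
  (m≡n+o⇒m∸n≡o (a + d + a) {d + a + d} (solve (a ∷ d ∷ [])))

ψ₂-hi : ∀ p → ψ₂ (hi p) ≡ lo (swap p)
ψ₂-hi (a , d) = cong₂ _,_
  (m≡n+o⇒m∸n≡o (a + d + a) {d} (solve (a ∷ d ∷ [])))
  (m≡n+o⇒m∸n≡o (a + d + a) {d + (d + a)} (solve (a ∷ d ∷ [])))

σ-hi : ∀ p → σ (hi p) ≡ lo p
σ-hi (a , d) = cong₂ _,_ (m+n∸m≡n (a + d) a) (+-comm (a + d) a)

Admissible-swap : ∀ {s t p} → t ≤ s → Admissible s t p → Admissible s t (swap p)
Admissible-swap {p = a , d} t≤s (c , _ , a+d≤t) =
  Coprime.sym c , ≤-trans (≤-trans (m≤n+m d a) a+d≤t) t≤s , ≤-trans (≤-reflexive (+-comm d a)) a+d≤t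

Admissible-transpose : ∀ {s t p} → t ≤ s → Admissible s t p → Admissible t s p
Admissible-transpose {p = a , d} t≤s (c , _ , a+d≤t) = c , ≤-trans (m≤m+n a d) a+d≤t , ≤-trans a+d≤t t≤s

module Conjugate {A P : Frac → Set} {g : Frac → Frac} (view : ∀ {x} → A x → Image g P x)
                 (f g′ τ : Frac → Frac) (f∘g≡g′∘τ : ∀ p → f (g p) ≡ g′ (τ p)) where

  wellDefined : (Q B : Frac → Set) →
    (∀ {p} → P p → Q (τ p)) → (∀ {p} → Q p → B (g′ p)) → WellDefined A B f
  wellDefined Q B P⇒Q Q⇒B x Ax with view Ax
  ... | image {p} Pp = subst B (sym (f∘g≡g′∘τ p)) (Q⇒B (P⇒Q Pp))

  orderPreserving : (∀ {p q} → g p <F g q → g′ (τ p) <F g′ (τ q)) → OrderPreserving A f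
  orderPreserving mono x y Ax Ay lt with view Ax | view Ay
  ... | image {p} _ | image {q} _ =
    subst₂ _<F_ (sym (f∘g≡g′∘τ p)) (sym (f∘g≡g′∘τ q)) (mono lt)

  orderReversing : (∀ {p q} → g p <F g q → g′ (τ q) <F g′ (τ p)) → OrderReversing A f
  orderReversing anti x y Ax Ay lt with view Ax | view Ay
  ... | image {p} _ | image {q} _ =
    subst₂ _<F_ (sym (f∘g≡g′∘τ q)) (sym (f∘g≡g′∘τ p)) (anti lt)

  injectiveOn : (∀ {p q} → g′ (τ p) ≡ g′ (τ q) → p ≡ q) → InjectiveOn A f
  injectiveOn inj x y Ax Ay eq with view Ax | view Ay
  ... | image {p} _ | image {q} _ =
    cong g (inj (trans (sym (f∘g≡g′∘τ p)) (trans eq (f∘g≡g′∘τ q))))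

swap-conjugate-surjective : ∀ {A P : Frac → Set} {g f : Frac → Frac} →
  (∀ {x} → A x → Image g P x) → (∀ p → f (g p) ≡ g (swap p)) →
  (∀ {p} → P p → A (g p)) → (∀ {p} → P p → P (swap p)) → SurjectiveOnto A A f
swap-conjugate-surjective {g = g} view f∘g≡g∘swap P⇒A P-swap y Ay with view Ay
... | image {p} Pp = g (swap p) , P⇒A (P-swap Pp) , f∘g≡g∘swap (swap p)

module _ {n m : ℕ} (m≤n : m ≤ n) where

  lower-half-maps : n ≤ 2 * m →
      (WellDefined (InLo n m) (InLo n m) φ₁ × OrderReversing (InLo n m) φ₁ × BijectiveOnto (InLo n m) (InLo n m) φ₁)
      × (WellDefined (InLo n m) (InHi n m) φ₂ × OrderPreserving (InLo n m) φ₂ × InjectiveOn (InLo n m) φ₂)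
      × (WellDefined (InLo n m) (InHi n m) σ × OrderReversing (InLo n m) σ × InjectiveOn (InLo n m) σ)
  lower-half-maps n≤2m =
      ( Φ₁.wellDefined (Admissible m (n ∸ m)) (InLo n m) (Admissible-swap n∸m≤m) (lo-InLo m≤n)
      , Φ₁.orderReversing (λ {p} {q} → lo-<F (swap q) (swap p) ∘ swap-<F p q ∘ lo-<F⁻¹ p q)
      , Φ₁.injectiveOn (λ {p} {q} → cong swap ∘ lo-injective {swap p} {swap q})
      , swap-conjugate-surjective (lo-view m≤n) φ₁-lo (lo-InLo m≤n) (Admissible-swap n∸m≤m) )
    , ( Φ₂.wellDefined (Admissible (n ∸ m) m) (InHi n m)
          (λ {p} → Admissible-transpose {p = swap p} n∸m≤m ∘ Admissible-swap n∸m≤m) (hi-InHi m≤n)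
      , Φ₂.orderPreserving (λ {p} {q} → hi-<F (swap q) (swap p) ∘ swap-<F p q ∘ lo-<F⁻¹ p q)
      , Φ₂.injectiveOn (λ {p} {q} → cong swap ∘ hi-injective {swap p} {swap q}) )
    , ( Σ.wellDefined (Admissible (n ∸ m) m) (InHi n m) (Admissible-transpose n∸m≤m) (hi-InHi m≤n)
      , Σ.orderReversing (λ {p} {q} → hi-<F p q ∘ lo-<F⁻¹ p q)
      , Σ.injectiveOn hi-injective )
    where
    n∸m≤m : n ∸ m ≤ m
    n∸m≤m = n≤2*m⇒n∸m≤m n≤2m
    module Φ₁ = Conjugate (lo-view m≤n) φ₁ lo swap φ₁-lo
    module Φ₂ = Conjugate (lo-view m≤n) φ₂ hi swap φ₂-lo
    module Σ = Conjugate (lo-view m≤n) σ hi id σ-lo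

  upper-half-maps : 2 * m ≤ n →
      (WellDefined (InHi n m) (InHi n m) ψ₁ × OrderReversing (InHi n m) ψ₁ × BijectiveOnto (InHi n m) (InHi n m) ψ₁)
      × (WellDefined (InHi n m) (InLo n m) ψ₂ × OrderPreserving (InHi n m) ψ₂ × InjectiveOn (InHi n m) ψ₂)
      × (WellDefined (InHi n m) (InLo n m) σ × OrderReversing (InHi n m) σ × InjectiveOn (InHi n m) σ)
  upper-half-maps 2m≤n =
      ( Ψ₁.wellDefined (Admissible (n ∸ m) m) (InHi n m) (Admissible-swap m≤n∸m) (hi-InHi m≤n)
      , Ψ₁.orderReversing (λ {p} {q} → hi-<F (swap p) (swap q) ∘ swap-<F q p ∘ hi-<F⁻¹ p q)
      , Ψ₁.injectiveOn (λ {p} {q} → cong swap ∘ hi-injective {swap p} {swap q})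
      , swap-conjugate-surjective (hi-view m≤n) ψ₁-hi (hi-InHi m≤n) (Admissible-swap m≤n∸m) )
    , ( Ψ₂.wellDefined (Admissible m (n ∸ m)) (InLo n m)
          (λ {p} → Admissible-transpose {p = swap p} m≤n∸m ∘ Admissible-swap m≤n∸m) (lo-InLo m≤n)
      , Ψ₂.orderPreserving (λ {p} {q} → lo-<F (swap p) (swap q) ∘ swap-<F q p ∘ hi-<F⁻¹ p q)
      , Ψ₂.injectiveOn (λ {p} {q} → cong swap ∘ lo-injective {swap p} {swap q}) )
    , ( Σ.wellDefined (Admissible m (n ∸ m)) (InLo n m) (Admissible-transpose m≤n∸m) (lo-InLo m≤n)
      , Σ.orderReversing (λ {p} {q} → lo-<F q p ∘ hi-<F⁻¹ p q)
      , Σ.injectiveOn lo-injective )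
    where
    m≤n∸m : m ≤ n ∸ m
    m≤n∸m = 2*m≤n⇒m≤n∸m 2m≤n
    module Ψ₁ = Conjugate (hi-view m≤n) ψ₁ hi swap ψ₁-hi
    module Ψ₂ = Conjugate (hi-view m≤n) ψ₂ lo swap ψ₂-hi
    module Σ = Conjugate (hi-view m≤n) σ lo id σ-hi

proposition1 : (n m : ℕ) → 1 < n → 0 < m → m < n →
    (n ≤ 2 * m →
    (WellDefined (InLo n m) (InLo n m) φ₁ × OrderReversing (InLo n m) φ₁ × BijectiveOnto (InLo n m) (InLo n m) φ₁)
    × (WellDefined (InLo n m) (InHi n m) φ₂ × OrderPreserving (InLo n m) φ₂ × InjectiveOn (InLo n m) φ₂)
    × (WellDefined (InLo n m) (InHi n m) σ × OrderReversing (InLo n m) σ × InjectiveOn (InLo n m) σ))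
    × (2 * m ≤ n →
    (WellDefined (InHi n m) (InHi n m) ψ₁ × OrderReversing (InHi n m) ψ₁ × BijectiveOnto (InHi n m) (InHi n m) ψ₁)
    × (WellDefined (InHi n m) (InLo n m) ψ₂ × OrderPreserving (InHi n m) ψ₂ × InjectiveOn (InHi n m) ψ₂)
    × (WellDefined (InHi n m) (InLo n m) σ × OrderReversing (InHi n m) σ × InjectiveOn (InHi n m) σ))
proposition1 n m _ _ m<n = lower-half-maps (<⇒≤ m<n) , upper-half-maps (<⇒≤ m<n)
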